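{- Let $q$ be a power of two, let $A$ be a $q$-modular witness in a graph $G$, and let $U\subseteq A$. For each $B\subseteq U$ let $n_B=|\{x\in A\setminus U:N(x)\cap U=B\}|$. Choose a lift $d$ modulo $2q$ of the common residue modulo $q$ of the degrees $\deg_A(v)$, $v\in A$, and define $b_A(v)\in\{0,1\}$ by $\deg_A(v)\equiv d+qb_A(v)\pmod{2q}$. Then: (1) There exists a family of pairwise disjoint $q$-element subsets of $A\setminus U$, each consisting of vertices with a common trace on $U$, such that, with $E$ their union and $W=A\setminus E$, the degrees $\deg_W(u)$, $u\in U$, are all congruent modulo $2q$, if and only if $[b_A|_U]\in\operatorname{Span}\{[\mathbf 1_B]: n_B\ge q\}$ in $\mathbb F_2^U/\langle\mathbf 1_U\rangle$. (2) If $n_B$ is divisible by $q$ for every $B\subseteq U$, then $U$ is $2q$-modular if and only if $[b_A|_U]=\sum_B\big(\tfrac{n_B}{q}\bmod 2\big)[\mathbf 1_B]$ in $\mathbb F_2^U/\langle\mathbf 1_U\rangle$.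
   Context: Graphs are finite simple; $\deg_S(v)$ is the degree of $v$ in the induced subgraph $G[S]$. A set $S$ is $q$-modular if $\deg_S(u)\equiv\deg_S(v)\pmod q$ for all $u,v\in S$. The trace of a vertex $x$ on $U$ is $N(x)\cap U$. $\mathbf 1_B$ is the indicator vector of $B$, $\mathbf 1_U$ the all-ones vector, and $\mathbb F_2^U/\langle\mathbf 1_U\rangle$ the quotient by constants; $b_A|_U$ is viewed as a vector in $\mathbb F_2^U$. -}

module Defs where

open import Data.Bool using (Bool; true; false; _∧_; not; _xor_; if_then_else_)
open import Data.Bool.Properties using () renaming (_≟_ to _≟ᴮ_)
open import Data.Nat using (ℕ; zero; suc; _+_; _*_; _^_; _≤_; _%_; _/_; _≡ᵇ_; NonZero)
open import Data.Nat.Properties using (m^n≢0)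
open import Data.Integer as ℤ using (ℤ; +_; _-_)
open import Data.Integer.Divisibility as ℤD using ()
open import Data.Fin using (Fin)
open import Data.Fin.Subset using (Subset; _∈_; _⊆_; _∪_; _─_; ∣_∣; outside; inside)
open import Data.Fin.Subset.Properties using (_⊆?_)
open import Data.Vec using (Vec; []; _∷_; lookup; tabulate)
open import Data.Vec.Properties using (≡-dec)
open import Data.List using (List; []; _∷_; [_]; _++_; map; foldr; filter; allFin)
open import Data.Nat.ListAction using (sum)
open import Data.List.Relation.Unary.All using (All)
open import Data.List.Relation.Unary.AllPairs using (AllPairs)
open import Data.Product using (Σ; ∃; _×_; _,_)
open import Data.Empty using (⊥)
open import Relation.Nullary using (¬_)
open import Relation.Nullary.Decidable using (⌊_⌋)
open import Relation.Binary.PropositionalEquality using (_≡_)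

record Graph (n : ℕ) : Set where
  field
    adj    : Fin n → Fin n → Bool
    sym    : ∀ u v → adj u v ≡ adj v u
    irrefl : ∀ v → adj v v ≡ false
open Graph public

count : ∀ {n} → (Fin n → Bool) → ℕ
count {n} p = sum (map (λ i → if p i then 1 else 0) (allFin n))

deg : ∀ {n} → Graph n → Subset n → Fin n → ℕ
deg G S v = count (λ w → lookup S w ∧ adj G v w)

_≡_[mod_] : ℕ → ℕ → ℕ → Set
a ≡ b [mod m ] = (+ m) ℤD.∣ ((+ a) - (+ b))

IsModular : ∀ {n} → Graph n → ℕ → Subset n → Set
IsModular G q S = ∀ u v → u ∈ S → v ∈ S → deg G S u ≡ deg G S v [mod q ]

trace : ∀ {n} → Graph n → Subset n → Fin n → Subset n
trace G U x = tabulate (λ u → lookup U u ∧ adj G x u)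

nB : ∀ {n} → Graph n → Subset n → Subset n → Subset n → ℕ
nB G A U B = count (λ x → lookup A x ∧ (not (lookup U x) ∧ ⌊ ≡-dec _≟ᴮ_ (trace G U x) B ⌋))

allSubsets : ∀ n → List (Subset n)
allSubsets zero    = [ [] ]
allSubsets (suc n) = map (outside ∷_) (allSubsets n) ++ map (inside ∷_) (allSubsets n)

subsetsOf : ∀ {n} → Subset n → List (Subset n)
subsetsOf {n} U = filter (λ B → B ⊆? U) (allSubsets n)

sumInd : ∀ {n} → List (Subset n) → Fin n → Bool
sumInd Bs u = foldr (λ B acc → lookup B u xor acc) false Bs

-- [v] ∈ Span{ [1_B] : Gen B } in F_2^U / ⟨1_U⟩ :
-- v|_U = c·1_U + Σ_{B ∈ Bs} 1_B|_U for some list Bs of generators and constant c.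
InSpanModConst : ∀ {n} → Subset n → (Subset n → Set) → (Fin n → Bool) → Set
InSpanModConst U Gen v =
  Σ (List _) λ Bs → All Gen Bs × Σ Bool λ c → ∀ u → u ∈ U → v u ≡ (c xor sumInd Bs u)

EqModConst : ∀ {n} → Subset n → (Fin n → Bool) → (Fin n → Bool) → Set
EqModConst U v w = Σ Bool λ c → ∀ u → u ∈ U → v u ≡ (c xor w u)

Disjoint : ∀ {n} → Subset n → Subset n → Set
Disjoint F F′ = ∀ x → x ∈ F → x ∈ F′ → ⊥

unionAll : ∀ {n} → List (Subset n) → Subset n
unionAll = foldr _∪_ Data.Fin.Subset.⊥

GoodPart : ∀ {n} → Graph n → ℕ → Subset n → Subset n → Subset n → Set
GoodPart G q A U F =
  (∀ x → x ∈ F → (x ∈ A × ¬ (x ∈ U))) × (∣ F ∣ ≡ q)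
  × (∀ x y → x ∈ F → y ∈ F → trace G U x ≡ trace G U y)

bit : Bool → ℕ
bit b = if b then 1 else 0


oddQuot : ℕ → ℕ → Bool
oddQuot k m = ((_/_ m (2 ^ k) {{m^n≢0 2 k}}) % 2) ≡ᵇ 1

weightedSum : ∀ {n} → Graph n → ℕ → Subset n → Subset n → Fin n → Bool
weightedSum G k A U u =
  foldr (λ B acc → (oddQuot k (nB G A U B) ∧ lookup B u) xor acc) false (subsetsOf U)

-- For u ∈ U write deg_A(u) = x(u) + q·s(u), where x(u) is the degree of u in the set that
-- is kept and s(u) counts, in units of q, the neighbours of u that are dropped. Since
-- deg_A(u) ≡ d + q·b(u) (mod 2q), this gives x(u) ≡ d + q·(b(u) ⊕ s(u) mod 2) (mod 2q), so the x(u)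
-- are all congruent modulo 2q exactly when b + (s mod 2) is constant on U. Removing a q-set whose
-- vertices have trace B lowers deg(u) by q·1_B(u), which gives (1): a family of such sets yields
-- s mod 2 = Σ 1_B, and conversely a combination of generators, after cancelling repeated ones, is
-- realised by disjoint q-sets picked among the n_B ≥ q vertices of each trace B. For (2), the vertices
-- of A ∖ U contribute Σ_B n_B·1_B(u) = q·Σ_B (n_B/q)·1_B(u) to deg_A(u).

module Submission where

open import Defs hiding (sym)
open import Data.Bool using (Bool; true; false; _∧_; _∨_; not; _xor_)
import Data.Bool.Properties as BoolP
open import Data.Nat as ℕ using (ℕ; zero; suc; _+_; _*_; _^_; _≤_; _≡ᵇ_; z≤n; s≤s⁻¹; ⌊_/2⌋; NonZero)
import Data.Nat.Properties as ℕP
open import Data.Nat.ListAction using (sum)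
open import Algebra.Properties.Semiring.Sum ℕP.+-*-semiring
  using (sum-syntax; ∑-distrib-+; sum-cong-≗; *-distribʳ-sum; sum-replicate-zero) renaming (sum to ∑)
import Data.Nat.Divisibility as ℕ∣
open import Data.Nat.DivMod using (_/_; _%_; [m+kn]%n≡m%n; m/n*n≡m)
open import Data.Nat.Divisibility using (_∣_)
open import Data.Integer as ℤ using (ℤ; +_)
import Data.Integer.Properties as ℤP
open import Data.Integer.Divisibility.Signed as ℤ∣ using (∣ᵤ⇒∣; ∣⇒∣ᵤ) renaming (_∣_ to _∣ℤ_)
open import Data.Fin using (Fin; zero; suc)
open import Data.Fin.Subset as Subset using (Subset; _∈_; _⊆_; _─_; _∪_; ∣_∣; inside; outside)
open import Data.Fin.Subset.Properties using (_⊆?_; nonempty?; Empty-unique; ∉⊥; ∣⊥∣≡0; x∈p∪q⁻)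
open import Data.Vec using ([]; _∷_; lookup; here; there)
import Data.Vec.Properties as VecP
open import Data.List as List using (List; []; _∷_; map)
open import Data.List.Membership.Propositional using () renaming (_∈_ to _∈ˡ_)
open import Data.List.Membership.Propositional.Properties using (∈-map⁺; ∈-map⁻; ∈-++⁺ˡ; ∈-++⁺ʳ; ∈-filter⁺)
open import Data.List.Relation.Unary.Any using (here; there)
open import Data.List.Relation.Unary.All.Properties using (all-filter)
open import Data.List.Relation.Unary.Unique.Propositional.Properties as Unique using ()
import Data.List.Properties as ListP
open import Data.List.Relation.Unary.All as All using (All; []; _∷_)
open import Data.List.Relation.Unary.AllPairs using (AllPairs; []; _∷_)
open import Data.List.Relation.Binary.Pointwise using (Pointwise; []; _∷_)
open import Data.List.Relation.Unary.Unique.Propositional using (Unique)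
open import Relation.Binary.Definitions using (DecidableEquality)
open import Data.Sum using (inj₁; inj₂)
open import Data.Product using (Σ; _×_; _,_; proj₁; proj₂)
open import Function using (id; _∘_)
open import Function.Bundles using (_⇔_; mk⇔; module Equivalence)
import Function.Properties.Equivalence as ⇔
open import Relation.Nullary using (¬_; yes; no; contradiction)
open import Relation.Nullary.Decidable using (⌊_⌋)
open import Relation.Binary.PropositionalEquality
  using (_≡_; refl; sym; trans; cong; cong₂; subst; module ≡-Reasoning)
import Data.Nat.Solver as ℕSolver
import Data.Integer.Solver as ℤSolver

open Equivalence using (to; from)

xor-cancelʳ : ∀ x y → (x xor y) xor y ≡ x
xor-cancelʳ x y = begin
  (x xor y) xor y  ≡⟨ BoolP.xor-assoc x y y ⟩
  x xor (y xor y)  ≡⟨ cong (x xor_) (BoolP.xor-same y) ⟩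
  x xor false      ≡⟨ BoolP.xor-identityʳ x ⟩
  x                ∎
  where open ≡-Reasoning

xor-move⇔ : ∀ x y c → x xor y ≡ c ⇔ x ≡ c xor y
xor-move⇔ x y c = mk⇔ (λ { refl → sym (xor-cancelʳ x y) }) (λ { refl → xor-cancelʳ c y })

xor-cancelˡ : ∀ x y → x xor (x xor y) ≡ y
xor-cancelˡ x y = begin
  x xor (x xor y)  ≡⟨ BoolP.xor-assoc x x y ⟨
  (x xor x) xor y  ≡⟨ cong (_xor y) (BoolP.xor-same x) ⟩
  y                ∎
  where open ≡-Reasoning

xor-swap : ∀ x y z → x xor (y xor z) ≡ y xor (x xor z)
xor-swap x y z = begin
  x xor (y xor z)  ≡⟨ BoolP.xor-assoc x y z ⟨
  (x xor y) xor z  ≡⟨ cong (_xor z) (BoolP.xor-comm x y) ⟩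
  (y xor x) xor z  ≡⟨ BoolP.xor-assoc y x z ⟩
  y xor (x xor z)  ∎
  where open ≡-Reasoning

odd : ℕ → Bool
odd zero    = false
odd (suc m) = not (odd m)

odd-+ : ∀ m n → odd (m + n) ≡ odd m xor odd n
odd-+ zero    n = refl
odd-+ (suc m) n = trans (cong not (odd-+ m n)) (BoolP.not-distribˡ-xor (odd m) (odd n))

odd-bit : ∀ b → odd (bit b) ≡ b
odd-bit true  = refl
odd-bit false = refl

odd-*-bit : ∀ m b → odd (m * bit b) ≡ odd m ∧ b
odd-*-bit m true  = trans (cong odd (ℕP.*-identityʳ m)) (sym (BoolP.∧-identityʳ (odd m)))
odd-*-bit m false = trans (cong odd (ℕP.*-zeroʳ m)) (sym (BoolP.∧-zeroʳ (odd m)))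

odd-decomposition : ∀ m → m ≡ bit (odd m) + 2 * ⌊ m /2⌋
odd-decomposition 0             = refl
odd-decomposition 1             = refl
odd-decomposition (suc (suc m)) = begin
  2 + m                                     ≡⟨ cong (λ t → 2 + t) (odd-decomposition m) ⟩
  2 + (bit (odd m) + 2 * ⌊ m /2⌋)           ≡⟨ solve 2 (λ b h → con 2 :+ (b :+ con 2 :* h)
                                                    := b :+ con 2 :* (con 1 :+ h)) refl (bit (odd m)) ⌊ m /2⌋ ⟩
  bit (odd m) + 2 * suc ⌊ m /2⌋             ≡⟨ cong (λ b → bit b + 2 * suc ⌊ m /2⌋) (sym (BoolP.not-involutive (odd m))) ⟩
  bit (odd (suc (suc m))) + 2 * ⌊ suc (suc m) /2⌋ ∎
  where open ≡-Reasoning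
        open ℕSolver.+-*-Solver

odd≡%2 : ∀ m → ((m % 2) ≡ᵇ 1) ≡ odd m
odd≡%2 m = begin
  (m % 2) ≡ᵇ 1                                ≡⟨ cong (λ t → (t % 2) ≡ᵇ 1) (odd-decomposition m) ⟩
  ((bit (odd m) + 2 * ⌊ m /2⌋) % 2) ≡ᵇ 1      ≡⟨ cong (λ t → ((bit (odd m) + t) % 2) ≡ᵇ 1) (ℕP.*-comm 2 ⌊ m /2⌋) ⟩
  ((bit (odd m) + ⌊ m /2⌋ * 2) % 2) ≡ᵇ 1      ≡⟨ cong (_≡ᵇ 1) ([m+kn]%n≡m%n (bit (odd m)) ⌊ m /2⌋ 2) ⟩
  (bit (odd m) % 2) ≡ᵇ 1                      ≡⟨ bit%2 (odd m) ⟩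
  odd m                                       ∎
  where
  open ≡-Reasoning
  bit%2 : ∀ b → ((bit b % 2) ≡ᵇ 1) ≡ b
  bit%2 true  = refl
  bit%2 false = refl

odd-sum : ∀ {X : Set} (f : X → ℕ) (L : List X)
        → odd (sum (map f L)) ≡ List.foldr (λ x acc → odd (f x) xor acc) false L
odd-sum f []      = refl
odd-sum f (x ∷ L) = trans (odd-+ (f x) _) (cong (odd (f x) xor_) (odd-sum f L))

-- Congruences modulo 2q

toℤ-+* : ∀ a b c → + (a + b * c) ≡ + a ℤ.+ + b ℤ.* + c
toℤ-+* a b c = trans (ℤP.pos-+ a (b * c)) (cong (λ z → + a ℤ.+ z) (ℤP.pos-* b c))

2∣bit-bit⇔≡ : ∀ b c → + 2 ∣ℤ (+ bit b ℤ.- + bit c) ⇔ b ≡ c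
2∣bit-bit⇔≡ false false = mk⇔ (λ _ → refl) (λ _ → ℤ∣.divides ℤ.0ℤ refl)
2∣bit-bit⇔≡ true  true  = mk⇔ (λ _ → refl) (λ _ → ℤ∣.divides ℤ.0ℤ refl)
2∣bit-bit⇔≡ false true  = mk⇔ (λ h → contradiction (ℕ∣.∣1⇒≡1 (∣⇒∣ᵤ h)) λ ()) λ ()
2∣bit-bit⇔≡ true  false = mk⇔ (λ h → contradiction (ℕ∣.∣1⇒≡1 (∣⇒∣ᵤ h)) λ ()) λ ()

2∣-⇔odd≡ : ∀ m n → + 2 ∣ℤ (+ m ℤ.- + n) ⇔ odd m ≡ odd n
2∣-⇔odd≡ m n = mk⇔
  (λ h → to (2∣bit-bit⇔≡ (odd m) (odd n)) (ℤ∣.∣m+n∣n⇒∣m (subst (+ 2 ∣ℤ_) split h) 2∣2*halves))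
  (λ e → subst (+ 2 ∣ℤ_) (sym split) (ℤ∣.∣m∣n⇒∣m+n (from (2∣bit-bit⇔≡ (odd m) (odd n)) e) 2∣2*halves))
  where
  open ℤSolver.+-*-Solver
  toℤ-odd-decomposition : ∀ m → + m ≡ + bit (odd m) ℤ.+ + 2 ℤ.* + ⌊ m /2⌋
  toℤ-odd-decomposition m = trans (cong +_ (odd-decomposition m)) (toℤ-+* (bit (odd m)) 2 ⌊ m /2⌋)
  halves : ℤ
  halves = + ⌊ m /2⌋ ℤ.- + ⌊ n /2⌋
  split : + m ℤ.- + n ≡ (+ bit (odd m) ℤ.- + bit (odd n)) ℤ.+ + 2 ℤ.* halves
  split = trans (cong₂ ℤ._-_ (toℤ-odd-decomposition m) (toℤ-odd-decomposition n))
                (solve 4 (λ a b s t → (a :+ con (+ 2) :* s) :- (b :+ con (+ 2) :* t)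
                                      := (a :- b) :+ con (+ 2) :* (s :- t)) refl
                   (+ bit (odd m)) (+ bit (odd n)) (+ ⌊ m /2⌋) (+ ⌊ n /2⌋))
  2∣2*halves : + 2 ∣ℤ + 2 ℤ.* halves
  2∣2*halves = ℤ∣.∣m⇒∣m*n halves ℤ∣.∣-refl

2q≡q*2 : ∀ q → + (2 * q) ≡ + q ℤ.* + 2
2q≡q*2 q = trans (ℤP.pos-* 2 q) (ℤP.*-comm (+ 2) (+ q))

2∣⇒[2q]∣q* : ∀ q {z} → + 2 ∣ℤ z → + (2 * q) ∣ℤ + q ℤ.* z
2∣⇒[2q]∣q* q {z} h = subst (_∣ℤ + q ℤ.* z) (sym (2q≡q*2 q)) (ℤ∣.*-monoʳ-∣ (+ q) h)

[2q]∣q*⇔2∣ : ∀ q .{{_ : NonZero q}} z → + (2 * q) ∣ℤ + q ℤ.* z ⇔ + 2 ∣ℤ z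
[2q]∣q*⇔2∣ q z = mk⇔
  (λ h → ℤ∣.*-cancelˡ-∣ (+ q) (subst (_∣ℤ + q ℤ.* z) (2q≡q*2 q) h))
  (2∣⇒[2q]∣q* q)

≡-mod⇒∣ : ∀ {m} a b → a ≡ b [mod m ] → + m ∣ℤ (+ a ℤ.- + b)
≡-mod⇒∣ a b = ∣ᵤ⇒∣

≡-mod-sym : ∀ {m} a b → a ≡ b [mod m ] → b ≡ a [mod m ]
≡-mod-sym a b h = ∣⇒∣ᵤ (subst (+ _ ∣ℤ_) (negate-minus (+ a) (+ b)) (ℤ∣.∣m⇒∣-m (≡-mod⇒∣ a b h)))
  where
  open ℤSolver.+-*-Solver
  negate-minus : ∀ x y → ℤ.- (x ℤ.- y) ≡ y ℤ.- x
  negate-minus = solve 2 (λ x y → :- (x :- y) := y :- x) refl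

≡-mod-trans : ∀ {m} a b c → a ≡ b [mod m ] → b ≡ c [mod m ] → a ≡ c [mod m ]
≡-mod-trans a b c h h′ =
  ∣⇒∣ᵤ (subst (+ _ ∣ℤ_) (ℤP.+-minus-telescope (+ a) (+ b) (+ c)) (ℤ∣.∣m∣n⇒∣m+n (≡-mod⇒∣ a b h) (≡-mod⇒∣ b c h′)))

≡-mod-bit⇔ : ∀ {q} .{{_ : NonZero q}} d β γ → ((d + q * bit β) ≡ d + q * bit γ [mod 2 * q ]) ⇔ β ≡ γ
≡-mod-bit⇔ {q} d β γ = mk⇔
  (λ h → to (2∣bit-bit⇔≡ β γ) (to ([2q]∣q*⇔2∣ q _) (subst (+ _ ∣ℤ_) difference (≡-mod⇒∣ (d + q * bit β) (d + q * bit γ) h))))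
  (λ e → ∣⇒∣ᵤ (subst (+ _ ∣ℤ_) (sym difference) (2∣⇒[2q]∣q* q (from (2∣bit-bit⇔≡ β γ) e))))
  where
  open ℤSolver.+-*-Solver
  difference : + (d + q * bit β) ℤ.- + (d + q * bit γ) ≡ + q ℤ.* (+ bit β ℤ.- + bit γ)
  difference = trans (cong₂ ℤ._-_ (toℤ-+* d q (bit β)) (toℤ-+* d q (bit γ)))
    (solve 4 (λ d q b c → (d :+ q :* b) :- (d :+ q :* c) := q :* (b :- c)) refl (+ d) (+ q) (+ bit β) (+ bit γ))

≡-mod-shift : ∀ {q a x s d} β → a ≡ x + q * s → a ≡ d + q * bit β [mod 2 * q ]
            → x ≡ d + q * bit (β xor odd s) [mod 2 * q ]
≡-mod-shift {q} {_} {x} {s} {d} β refl h =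
  ∣⇒∣ᵤ (subst (+ _ ∣ℤ_) (sym regroup) (ℤ∣.∣m∣n⇒∣m-n (≡-mod⇒∣ (x + q * s) (d + q * bit β) h) (2∣⇒[2q]∣q* q 2∣carry)))
  where
  open ℤSolver.+-*-Solver
  γ = β xor odd s
  regroup : + x ℤ.- + (d + q * bit γ)
          ≡ (+ (x + q * s) ℤ.- + (d + q * bit β)) ℤ.- + q ℤ.* ((+ s ℤ.+ + bit γ) ℤ.- + bit β)
  regroup = trans (cong (λ z → + x ℤ.- z) (toℤ-+* d q (bit γ)))
    (trans (solve 6 (λ x q s d g b → x :- (d :+ q :* g)
                       := ((x :+ q :* s) :- (d :+ q :* b)) :- q :* ((s :+ g) :- b)) refl
                    (+ x) (+ q) (+ s) (+ d) (+ bit γ) (+ bit β))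
           (cong₂ (λ u v → (u ℤ.- v) ℤ.- + q ℤ.* ((+ s ℤ.+ + bit γ) ℤ.- + bit β))
                  (sym (toℤ-+* x q s)) (sym (toℤ-+* d q (bit β)))))
  odd-carry : odd (s + bit γ) ≡ odd (bit β)
  odd-carry = begin
    odd (s + bit γ)          ≡⟨ odd-+ s (bit γ) ⟩
    odd s xor odd (bit γ)    ≡⟨ cong (odd s xor_) (odd-bit γ) ⟩
    odd s xor (β xor odd s)  ≡⟨ BoolP.xor-comm (odd s) γ ⟩
    (β xor odd s) xor odd s  ≡⟨ xor-cancelʳ β (odd s) ⟩
    β                        ≡⟨ sym (odd-bit β) ⟩
    odd (bit β)              ∎
    where open ≡-Reasoning
  2∣carry : + 2 ∣ℤ ((+ s ℤ.+ + bit γ) ℤ.- + bit β)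
  2∣carry = subst (λ z → + 2 ∣ℤ (z ℤ.- + bit β)) (ℤP.pos-+ s (bit γ)) (from (2∣-⇔odd≡ (s + bit γ) (bit β)) odd-carry)

≡-mod-bits⇔ : ∀ {q} .{{_ : NonZero q}} x y d β γ
  → x ≡ d + q * bit β [mod 2 * q ] → y ≡ d + q * bit γ [mod 2 * q ]
  → (x ≡ y [mod 2 * q ]) ⇔ β ≡ γ
≡-mod-bits⇔ {q} x y d β γ hx hy = mk⇔
  (λ e → to (≡-mod-bit⇔ d β γ) (≡-mod-trans rβ x rγ (≡-mod-sym x rβ hx) (≡-mod-trans x y rγ e hy)))
  (λ e → ≡-mod-trans x rβ y hx (≡-mod-trans rβ rγ y (from (≡-mod-bit⇔ d β γ) e) (≡-mod-sym y rγ hy)))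
  where
  rβ rγ : ℕ
  rβ = d + q * bit β
  rγ = d + q * bit γ

EqModConst-cong : ∀ {n} (U : Subset n) (b : Fin n → Bool) {w w′ : Fin n → Bool}
  → (∀ u → w u ≡ w′ u) → EqModConst U b w ⇔ EqModConst U b w′
EqModConst-cong U b w≗w′ = mk⇔ (transport w≗w′) (transport (sym ∘ w≗w′))
  where
  transport : ∀ {w w′} → (∀ u → w u ≡ w′ u) → EqModConst U b w → EqModConst U b w′
  transport w≗w′ (c , h) = c , λ u u∈U → trans (h u u∈U) (cong (c xor_) (w≗w′ u))

pairwise-xor≡⇔EqModConst : ∀ {n} (U : Subset n) (b w : Fin n → Bool)
  → (∀ u v → u ∈ U → v ∈ U → b u xor w u ≡ b v xor w v) ⇔ EqModConst U b w
pairwise-xor≡⇔EqModConst U b w = mk⇔ constant pairwise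
  where
  constant : (∀ u v → u ∈ U → v ∈ U → b u xor w u ≡ b v xor w v) → EqModConst U b w
  constant h with nonempty? U
  ... | yes (u₀ , u₀∈U) = b u₀ xor w u₀ , λ u u∈U → to (xor-move⇔ (b u) (w u) _) (h u u₀ u∈U u₀∈U)
  ... | no U-empty      = false , λ u u∈U → contradiction (u , u∈U) U-empty
  pairwise : EqModConst U b w → ∀ u v → u ∈ U → v ∈ U → b u xor w u ≡ b v xor w v
  pairwise (c , h) u v u∈U v∈U = trans (from (xor-move⇔ (b u) (w u) c) (h u u∈U))
                                       (sym (from (xor-move⇔ (b v) (w v) c) (h v v∈U)))

congruentOn⇔EqModConst : ∀ {n} (U : Subset n) {q} .{{_ : NonZero q}} d (a x s : Fin n → ℕ) (b : Fin n → Bool)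
  → (∀ u → u ∈ U → a u ≡ d + q * bit (b u) [mod 2 * q ])
  → (∀ u → u ∈ U → a u ≡ x u + q * s u)
  → (∀ u v → u ∈ U → v ∈ U → x u ≡ x v [mod 2 * q ]) ⇔ EqModConst U b (odd ∘ s)
congruentOn⇔EqModConst U {q} d a x s b a≡bit a≡x+qs = ⇔.trans
  (mk⇔ (λ h u v u∈U v∈U → to   (bits u v u∈U v∈U) (h u v u∈U v∈U))
       (λ h u v u∈U v∈U → from (bits u v u∈U v∈U) (h u v u∈U v∈U)))
  (pairwise-xor≡⇔EqModConst U b (odd ∘ s))
  where
  bit-of : ∀ u → u ∈ U → x u ≡ d + q * bit (b u xor odd (s u)) [mod 2 * q ]
  bit-of u u∈U = ≡-mod-shift {q} {a u} {x u} {s u} {d} (b u) (a≡x+qs u u∈U) (a≡bit u u∈U)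
  bits : ∀ u v → u ∈ U → v ∈ U
       → (x u ≡ x v [mod 2 * q ]) ⇔ (b u xor odd (s u) ≡ b v xor odd (s v))
  bits u v u∈U v∈U = ≡-mod-bits⇔ (x u) (x v) d _ _ (bit-of u u∈U) (bit-of v v∈U)

sum-tabulate : ∀ {n} (f : Fin n → ℕ) → sum (List.tabulate f) ≡ ∑ f
sum-tabulate {zero}  f = refl
sum-tabulate {suc n} f = cong (λ t → f zero + t) (sum-tabulate (f ∘ suc))

count≡∑ : ∀ {n} (p : Fin n → Bool) → count p ≡ ∑[ i < n ] bit (p i)
count≡∑ p = trans (cong sum (ListP.map-tabulate id (bit ∘ p))) (sum-tabulate (bit ∘ p))

∣p∣≡∑ : ∀ {n} (p : Subset n) → ∣ p ∣ ≡ ∑[ i < n ] bit (lookup p i)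
∣p∣≡∑ []             = refl
∣p∣≡∑ (inside ∷ p)  = cong suc (∣p∣≡∑ p)
∣p∣≡∑ (outside ∷ p) = ∣p∣≡∑ p

∑-split : ∀ {n} {f g h : Fin n → ℕ} → (∀ i → f i ≡ g i + h i) → ∑ f ≡ ∑ g + ∑ h
∑-split {g = g} {h} f≗g+h = trans (sum-cong-≗ f≗g+h) (∑-distrib-+ g h)

∑-mono-≤ : ∀ {n} {f g : Fin n → ℕ} → (∀ i → f i ≤ g i) → ∑ f ≤ ∑ g
∑-mono-≤ {zero}  f≤g = z≤n
∑-mono-≤ {suc n} f≤g = ℕP.+-mono-≤ (f≤g zero) (∑-mono-≤ (f≤g ∘ suc))

∑-bit-mono : ∀ {n} {p r : Fin n → Bool} → (∀ i → p i ≡ true → r i ≡ true)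
           → ∑[ i < n ] bit (p i) ≤ ∑[ i < n ] bit (r i)
∑-bit-mono {p = p} {r} p⇒r = ∑-mono-≤ bit-mono
  where
  bit-mono : ∀ i → bit (p i) ≤ bit (r i)
  bit-mono i with p i in pᵢ
  ... | false = z≤n
  ... | true rewrite p⇒r i pᵢ = ℕP.≤-refl

choose : ∀ {n} (p : Fin n → Bool) m → m ≤ ∑[ i < n ] bit (p i)
       → Σ (Subset n) λ F → (∀ x → x ∈ F → p x ≡ true) × ∣ F ∣ ≡ m
choose {n} p zero _ = Subset.⊥ , (λ _ x∈⊥ → contradiction x∈⊥ ∉⊥) , ∣⊥∣≡0 n
choose {suc n} p (suc m) h with p zero in p₀
... | true with choose (p ∘ suc) m (s≤s⁻¹ h)
...   | F , F⊆p , ∣F∣≡m = inside ∷ F , (λ { zero here → p₀ ; (suc x) (there x∈F) → F⊆p x x∈F }) , cong suc ∣F∣≡m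
choose {suc n} p (suc m) h | false with choose (p ∘ suc) (suc m) h
...   | F , F⊆p , ∣F∣≡m = outside ∷ F , (λ { (suc x) (there x∈F) → F⊆p x x∈F }) , ∣F∣≡m

sum-map-zero : ∀ {X : Set} (L : List X) → sum (map (λ _ → 0) L) ≡ 0
sum-map-zero []      = refl
sum-map-zero (_ ∷ L) = sum-map-zero L

∑-sum-map-comm : ∀ {n} {X : Set} (L : List X) (h : X → Fin n → ℕ)
               → sum (map (λ x → ∑ (h x)) L) ≡ ∑[ w < n ] sum (map (λ x → h x w) L)
∑-sum-map-comm {n} []      h = sym (sum-replicate-zero n)
∑-sum-map-comm     (x ∷ L) h =
  trans (cong (λ t → ∑ (h x) + t) (∑-sum-map-comm L h)) (sym (∑-distrib-+ (h x) _))

sum-map-divisible : ∀ {X : Set} {q} .{{_ : NonZero q}} (L : List X) (f g : X → ℕ) → All (λ x → q ∣ f x) L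
                  → sum (map (λ x → f x * g x) L) ≡ q * sum (map (λ x → f x / q * g x) L)
sum-map-divisible {q = q} []      f g []         = sym (ℕP.*-zeroʳ q)
sum-map-divisible {q = q} (x ∷ L) f g (q∣fx ∷ q∣f) = begin
  f x * g x + sum (map (λ x → f x * g x) L)            ≡⟨ cong₂ _+_ head (sum-map-divisible L f g q∣f) ⟩
  q * (f x / q * g x) + q * sum (map (λ x → f x / q * g x) L)   ≡⟨ ℕP.*-distribˡ-+ q _ _ ⟨
  q * sum (map (λ x → f x / q * g x) (x ∷ L))          ∎
  where
  open ≡-Reasoning
  open ℕSolver.+-*-Solver
  head : f x * g x ≡ q * (f x / q * g x)
  head = trans (cong (_* g x) (sym (m/n*n≡m q∣fx)))
               (solve 3 (λ a q c → (a :* q) :* c := q :* (a :* c)) refl (f x / q) q (g x))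

module _ {X : Set} (_≟_ : DecidableEquality X) (g : X → ℕ) where

  sum-map-indicator-∉ : ∀ {t} L → All (λ x → ¬ t ≡ x) L → sum (map (λ x → bit ⌊ t ≟ x ⌋ * g x) L) ≡ 0
  sum-map-indicator-∉     []      []            = refl
  sum-map-indicator-∉ {t} (x ∷ L) (t≢x ∷ t∉L) with t ≟ x
  ... | yes t≡x = contradiction t≡x t≢x
  ... | no  _   = sum-map-indicator-∉ L t∉L

  sum-map-indicator : ∀ {L t} → Unique L → t ∈ˡ L → sum (map (λ x → bit ⌊ t ≟ x ⌋ * g x) L) ≡ g t
  sum-map-indicator {x ∷ L} {t} (x∉L ∷ uniq) t∈x∷L with t ≟ x | t∈x∷L
  ... | yes refl | _         = trans (cong₂ _+_ (ℕP.*-identityˡ (g t)) (sum-map-indicator-∉ L x∉L))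
                                     (ℕP.+-identityʳ (g t))
  ... | no  t≢x  | here t≡x  = contradiction t≡x t≢x
  ... | no  _    | there t∈L = sum-map-indicator uniq t∈L

-- Degrees

∈⇒lookup : ∀ {n} {S : Subset n} {x} → x ∈ S → lookup S x ≡ true
∈⇒lookup = VecP.[]=⇒lookup

lookup⇒∈ : ∀ {n} {S : Subset n} {x} → lookup S x ≡ true → x ∈ S
lookup⇒∈ {S = S} {x} = VecP.lookup⇒[]= x S

lookup-─ : ∀ {n} (S E : Subset n) w → lookup (S ─ E) w ≡ lookup S w ∧ not (lookup E w)
lookup-─ (s ∷ S) (inside ∷ E)  zero    = sym (BoolP.∧-zeroʳ s)
lookup-─ (s ∷ S) (outside ∷ E) zero    = sym (BoolP.∧-identityʳ s)
lookup-─ (_ ∷ S) (_ ∷ E)       (suc w) = lookup-─ S E w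

deg≡∑ : ∀ {n} (G : Graph n) S v → deg G S v ≡ ∑[ w < n ] bit (lookup S w ∧ adj G v w)
deg≡∑ G S v = count≡∑ (λ w → lookup S w ∧ adj G v w)

bit-∨-∧ : ∀ x y a → (x ≡ true → y ≡ false) → bit ((x ∨ y) ∧ a) ≡ bit (x ∧ a) + bit (y ∧ a)
bit-∨-∧ true  y a x⇒¬y rewrite x⇒¬y refl = sym (ℕP.+-identityʳ (bit a))
bit-∨-∧ false y a _    = refl

deg-∨ : ∀ {n} (G : Graph n) {S P Q : Subset n} v
  → (∀ w → lookup S w ≡ lookup P w ∨ lookup Q w)
  → (∀ w → lookup P w ≡ true → lookup Q w ≡ false)
  → deg G S v ≡ deg G P v + deg G Q v
deg-∨ G {S} {P} {Q} v S≡P∨Q P⇒¬Q = begin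
  deg G S v                                                          ≡⟨ deg≡∑ G S v ⟩
  ∑[ w < _ ] bit (lookup S w ∧ adj G v w)                            ≡⟨ ∑-split split ⟩
  ∑[ w < _ ] bit (lookup P w ∧ adj G v w)
    + ∑[ w < _ ] bit (lookup Q w ∧ adj G v w)                        ≡⟨ sym (cong₂ _+_ (deg≡∑ G P v) (deg≡∑ G Q v)) ⟩
  deg G P v + deg G Q v                                              ∎
  where
  open ≡-Reasoning
  split : ∀ w → bit (lookup S w ∧ adj G v w) ≡ bit (lookup P w ∧ adj G v w) + bit (lookup Q w ∧ adj G v w)
  split w = trans (cong (λ z → bit (z ∧ adj G v w)) (S≡P∨Q w)) (bit-∨-∧ _ _ _ (P⇒¬Q w))

deg-∪ : ∀ {n} (G : Graph n) {F E : Subset n} v → Disjoint F E → deg G (F ∪ E) v ≡ deg G F v + deg G E v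
deg-∪ G {F} {E} v F∩E≡∅ = deg-∨ G {F ∪ E} {F} {E} v (λ w → VecP.lookup-zipWith _∨_ w F E)
  (λ w F∋w → BoolP.¬-not (λ E∋w → F∩E≡∅ w (lookup⇒∈ F∋w) (lookup⇒∈ E∋w)))

deg-─ : ∀ {n} (G : Graph n) {S E : Subset n} v → E ⊆ S → deg G S v ≡ deg G (S ─ E) v + deg G E v
deg-─ G {S} {E} v E⊆S = deg-∨ G {S} {S ─ E} {E} v split disjoint
  where
  absorb : ∀ s e → (e ≡ true → s ≡ true) → s ≡ (s ∧ not e) ∨ e
  absorb true  true  _   = refl
  absorb true  false _   = refl
  absorb false false _   = refl
  absorb false true  e⇒s = e⇒s refl
  split : ∀ w → lookup S w ≡ lookup (S ─ E) w ∨ lookup E w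
  split w = trans (absorb _ _ (∈⇒lookup ∘ E⊆S ∘ lookup⇒∈))
                  (cong (_∨ lookup E w) (sym (lookup-─ S E w)))
  ∧-not⇒false : ∀ s e → s ∧ not e ≡ true → e ≡ false
  ∧-not⇒false true  false _ = refl
  ∧-not⇒false true  true  ()
  ∧-not⇒false false _     ()
  disjoint : ∀ w → lookup (S ─ E) w ≡ true → lookup E w ≡ false
  disjoint w S─E∋w = ∧-not⇒false _ _ (trans (sym (lookup-─ S E w)) S─E∋w)

deg-⊥ : ∀ {n} (G : Graph n) v → deg G Subset.⊥ v ≡ 0
deg-⊥ {n} G v = trans (deg≡∑ G Subset.⊥ v)
  (trans (sum-cong-≗ (λ w → cong (λ z → bit (z ∧ adj G v w)) (VecP.lookup-replicate w outside)))
         (sum-replicate-zero n))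

unionAll-⊆ : ∀ {n} {A : Subset n} {Fs} → All (_⊆ A) Fs → unionAll Fs ⊆ A
unionAll-⊆ [] x∈⊥ = contradiction x∈⊥ ∉⊥
unionAll-⊆ {Fs = F ∷ Fs} (F⊆A ∷ Fs⊆A) x∈F∪⋃ with x∈p∪q⁻ F (unionAll Fs) x∈F∪⋃
... | inj₁ x∈F = F⊆A x∈F
... | inj₂ x∈⋃ = unionAll-⊆ Fs⊆A x∈⋃

Disjoint-unionAll : ∀ {n} {F : Subset n} {Fs} → All (Disjoint F) Fs → Disjoint F (unionAll Fs)
Disjoint-unionAll [] x _ x∈⊥ = ∉⊥ x∈⊥
Disjoint-unionAll {Fs = F′ ∷ Fs} (F∩F′ ∷ F∩Fs) x x∈F x∈F′∪⋃ with x∈p∪q⁻ F′ (unionAll Fs) x∈F′∪⋃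
... | inj₁ x∈F′ = F∩F′ x x∈F x∈F′
... | inj₂ x∈⋃  = Disjoint-unionAll F∩Fs x x∈F x∈⋃

CommonTrace : ∀ {n} → Graph n → Subset n → Subset n → Subset n → Set
CommonTrace G U F B = ∀ x → x ∈ F → trace G U x ≡ B

adj≡lookup-trace : ∀ {n} (G : Graph n) {U : Subset n} u w → u ∈ U → adj G u w ≡ lookup (trace G U w) u
adj≡lookup-trace G {U} u w u∈U = begin
  adj G u w               ≡⟨ Graph.sym G u w ⟩
  adj G w u               ≡⟨ cong (_∧ adj G w u) (∈⇒lookup u∈U) ⟨
  lookup U u ∧ adj G w u  ≡⟨ VecP.lookup∘tabulate (λ u → lookup U u ∧ adj G w u) u ⟨
  lookup (trace G U w) u  ∎
  where open ≡-Reasoning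

trace⊆ : ∀ {n} (G : Graph n) U x → trace G U x ⊆ U
trace⊆ G U x {u} u∈trace = lookup⇒∈ (BoolP.∧-conicalˡ _ _
  (trans (sym (VecP.lookup∘tabulate (λ u → lookup U u ∧ adj G x u) u)) (∈⇒lookup u∈trace)))

deg-CommonTrace : ∀ {n} (G : Graph n) {U F B : Subset n} u → u ∈ U → CommonTrace G U F B
                → deg G F u ≡ ∣ F ∣ * bit (lookup B u)
deg-CommonTrace {n} G {U} {F} {B} u u∈U F↦B = begin
  deg G F u                                          ≡⟨ deg≡∑ G F u ⟩
  ∑[ w < n ] bit (lookup F w ∧ adj G u w)            ≡⟨ sum-cong-≗ pointwise ⟩
  ∑[ w < n ] (bit (lookup F w) * bit (lookup B u))   ≡⟨ *-distribʳ-sum (bit (lookup B u)) (bit ∘ lookup F) ⟨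
  ∑[ w < n ] bit (lookup F w) * bit (lookup B u)     ≡⟨ cong (_* bit (lookup B u)) (∣p∣≡∑ F) ⟨
  ∣ F ∣ * bit (lookup B u)                           ∎
  where
  open ≡-Reasoning
  pointwise : ∀ w → bit (lookup F w ∧ adj G u w) ≡ bit (lookup F w) * bit (lookup B u)
  pointwise w with lookup F w in F∋w
  ... | false = refl
  ... | true  = begin
    bit (adj G u w)               ≡⟨ cong bit (adj≡lookup-trace G u w u∈U) ⟩
    bit (lookup (trace G U w) u)  ≡⟨ cong (λ t → bit (lookup t u)) (F↦B w (lookup⇒∈ F∋w)) ⟩
    bit (lookup B u)              ≡⟨ ℕP.*-identityˡ _ ⟨
    1 * bit (lookup B u)          ∎

deg-unionAll : ∀ {n} (G : Graph n) {U : Subset n} {q Fs Bs} u → u ∈ U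
  → Pointwise (CommonTrace G U) Fs Bs → All (λ F → ∣ F ∣ ≡ q) Fs → AllPairs Disjoint Fs
  → deg G (unionAll Fs) u ≡ q * sum (map (λ B → bit (lookup B u)) Bs)
deg-unionAll G {q = q} u u∈U [] [] [] = trans (deg-⊥ G u) (sym (ℕP.*-zeroʳ q))
deg-unionAll G {q = q} {F ∷ Fs} {B ∷ Bs} u u∈U (F↦B ∷ Fs↦Bs) (∣F∣≡q ∷ sizes) (F∩Fs ∷ disjoint) = begin
  deg G (F ∪ unionAll Fs) u            ≡⟨ deg-∪ G u (Disjoint-unionAll F∩Fs) ⟩
  deg G F u + deg G (unionAll Fs) u    ≡⟨ cong₂ _+_ (deg-CommonTrace G u u∈U F↦B)
                                                    (deg-unionAll G u u∈U Fs↦Bs sizes disjoint) ⟩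
  ∣ F ∣ * bit (lookup B u) + q * Σbits ≡⟨ cong (λ m → m * bit (lookup B u) + q * Σbits) ∣F∣≡q ⟩
  q * bit (lookup B u) + q * Σbits     ≡⟨ ℕP.*-distribˡ-+ q _ _ ⟨
  q * (bit (lookup B u) + Σbits)       ∎
  where
  open ≡-Reasoning
  Σbits = sum (map (λ B → bit (lookup B u)) Bs)

_≟ˢ_ : ∀ {n} → DecidableEquality (Subset n)
_≟ˢ_ = VecP.≡-dec BoolP._≟_

tracedOutside : ∀ {n} → Graph n → (A U B : Subset n) → Fin n → Bool
tracedOutside G A U B x = lookup A x ∧ (not (lookup U x) ∧ ⌊ trace G U x ≟ˢ B ⌋)

nB≡∑ : ∀ {n} (G : Graph n) A U B → nB G A U B ≡ ∑[ x < n ] bit (tracedOutside G A U B x)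
nB≡∑ G A U B = count≡∑ (tracedOutside G A U B)

tracedOutside⇔ : ∀ {n} (G : Graph n) {A U B : Subset n} x
  → tracedOutside G A U B x ≡ true ⇔ (x ∈ A × ¬ x ∈ U × trace G U x ≡ B)
tracedOutside⇔ G {A} {U} {B} x = mk⇔ unpack pack
  where
  unpack : tracedOutside G A U B x ≡ true → x ∈ A × ¬ x ∈ U × trace G U x ≡ B
  unpack traced with lookup A x in A∋x | lookup U x in U∋x | trace G U x ≟ˢ B
  unpack refl | true | false | yes t≡B = lookup⇒∈ A∋x , (λ x∈U → contradiction (trans (sym U∋x) (∈⇒lookup x∈U)) λ ()) , t≡B
  pack : x ∈ A × ¬ x ∈ U × trace G U x ≡ B → tracedOutside G A U B x ≡ true
  pack (x∈A , x∉U , t≡B) with trace G U x ≟ˢ B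
  ... | no t≢B = contradiction t≡B t≢B
  ... | yes _ rewrite ∈⇒lookup x∈A | BoolP.¬-not (x∉U ∘ lookup⇒∈ {S = U}) = refl

Generator : ∀ {n} → Graph n → ℕ → (A U B : Subset n) → Set
Generator G q A U B = B ⊆ U × q ≤ nB G A U B

GoodPart-trace : ∀ {n} (G : Graph n) {q} .{{_ : NonZero q}} {A U F : Subset n}
  → GoodPart G q A U F → Σ (Subset n) λ B → CommonTrace G U F B × Generator G q A U B
GoodPart-trace {n} G {q} {A} {U} {F} (F⊆A─U , ∣F∣≡q , sameTrace) with nonempty? F
... | no F-empty =
  contradiction (trans (sym ∣F∣≡q) (trans (cong ∣_∣ (Empty-unique F-empty)) (∣⊥∣≡0 n))) (ℕ.≢-nonZero⁻¹ q)
... | yes (x₀ , x₀∈F) = trace G U x₀ , F↦t₀ , trace⊆ G U x₀ , q≤nB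
  where
  open ℕP.≤-Reasoning
  F↦t₀ : CommonTrace G U F (trace G U x₀)
  F↦t₀ x x∈F = sameTrace x x₀ x∈F x₀∈F
  F⇒traced : ∀ x → lookup F x ≡ true → tracedOutside G A U (trace G U x₀) x ≡ true
  F⇒traced x F∋x = from (tracedOutside⇔ G x) (proj₁ (F⊆A─U x x∈F) , proj₂ (F⊆A─U x x∈F) , F↦t₀ x x∈F)
    where x∈F = lookup⇒∈ F∋x
  q≤nB : q ≤ nB G A U (trace G U x₀)
  q≤nB = begin
    q                                                      ≡⟨ trans (sym ∣F∣≡q) (∣p∣≡∑ F) ⟩
    ∑[ x < n ] bit (lookup F x)                            ≤⟨ ∑-bit-mono F⇒traced ⟩
    ∑[ x < n ] bit (tracedOutside G A U (trace G U x₀) x)  ≡⟨ nB≡∑ G A U (trace G U x₀) ⟨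
    nB G A U (trace G U x₀)                                ∎

GoodPart-withTrace : ∀ {n} (G : Graph n) {q} {A U B : Subset n} → q ≤ nB G A U B
  → Σ (Subset n) λ F → CommonTrace G U F B × GoodPart G q A U F
GoodPart-withTrace G {q} {A} {U} {B} q≤nB with choose (tracedOutside G A U B) q (subst (q ≤_) (nB≡∑ G A U B) q≤nB)
... | F , F⊆traced , ∣F∣≡q = F , F↦B , (λ x x∈F → proj₁ (traced x x∈F) , proj₁ (proj₂ (traced x x∈F))) , ∣F∣≡q
                           , λ x y x∈F y∈F → trans (F↦B x x∈F) (sym (F↦B y y∈F))
  where
  traced : ∀ x → x ∈ F → x ∈ A × ¬ x ∈ U × trace G U x ≡ B
  traced x x∈F = to (tracedOutside⇔ G x) (F⊆traced x x∈F)
  F↦B : CommonTrace G U F B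
  F↦B x x∈F = proj₂ (proj₂ (traced x x∈F))

-- Balancing families

toggle : ∀ {n} → Subset n → List (Subset n) → List (Subset n)
toggle B []       = B ∷ []
toggle B (C ∷ Cs) with B ≟ˢ C
... | yes _ = Cs
... | no  _ = C ∷ toggle B Cs

-- Generators may repeat; cancelling them in pairs keeps their F₂-sum and makes the traces of the
-- parts built from them distinct, so that the parts are disjoint.
cancelPairs : ∀ {n} → List (Subset n) → List (Subset n)
cancelPairs = List.foldr toggle []

sumInd-toggle : ∀ {n} B (Cs : List (Subset n)) u → sumInd (toggle B Cs) u ≡ lookup B u xor sumInd Cs u
sumInd-toggle B []       u = refl
sumInd-toggle B (C ∷ Cs) u with B ≟ˢ C
... | yes refl = sym (xor-cancelˡ (lookup B u) (sumInd Cs u))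
... | no  _    = trans (cong (lookup C u xor_) (sumInd-toggle B Cs u)) (xor-swap (lookup C u) (lookup B u) _)

sumInd-cancelPairs : ∀ {n} (Bs : List (Subset n)) u → sumInd (cancelPairs Bs) u ≡ sumInd Bs u
sumInd-cancelPairs []       u = refl
sumInd-cancelPairs (B ∷ Bs) u =
  trans (sumInd-toggle B (cancelPairs Bs) u) (cong (lookup B u xor_) (sumInd-cancelPairs Bs u))

All-toggle : ∀ {n} {P : Subset n → Set} {B} Cs → P B → All P Cs → All P (toggle B Cs)
All-toggle         []       pB []          = pB ∷ []
All-toggle {B = B} (C ∷ Cs) pB (pC ∷ pCs) with B ≟ˢ C
... | yes _ = pCs
... | no  _ = pC ∷ All-toggle Cs pB pCs

All-cancelPairs : ∀ {n} {P : Subset n → Set} {Bs} → All P Bs → All P (cancelPairs Bs)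
All-cancelPairs []         = []
All-cancelPairs (pB ∷ pBs) = All-toggle _ pB (All-cancelPairs pBs)

Unique-toggle : ∀ {n} B {Cs : List (Subset n)} → Unique Cs → Unique (toggle B Cs)
Unique-toggle B {[]}     []             = [] ∷ []
Unique-toggle B {C ∷ Cs} (C∉Cs ∷ uniq) with B ≟ˢ C
... | yes _   = uniq
... | no  B≢C = All-toggle Cs (λ C≡B → B≢C (sym C≡B)) C∉Cs ∷ Unique-toggle B uniq

Unique-cancelPairs : ∀ {n} (Bs : List (Subset n)) → Unique (cancelPairs Bs)
Unique-cancelPairs []       = []
Unique-cancelPairs (B ∷ Bs) = Unique-toggle B (Unique-cancelPairs Bs)

distinctTraces⇒Disjoint : ∀ {n} (G : Graph n) {U : Subset n} {Fs Bs}
  → Pointwise (CommonTrace G U) Fs Bs → Unique Bs → AllPairs Disjoint Fs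
distinctTraces⇒Disjoint G         []             []            = []
distinctTraces⇒Disjoint G {U = U} (F↦B ∷ Fs↦Bs) (B∉Bs ∷ uniq) =
  apart F↦B Fs↦Bs B∉Bs ∷ distinctTraces⇒Disjoint G {U = U} Fs↦Bs uniq
  where
  apart : ∀ {F B Fs Bs} → CommonTrace G U F B → Pointwise (CommonTrace G U) Fs Bs
        → All (λ C → ¬ B ≡ C) Bs → All (Disjoint F) Fs
  apart F↦B []              []              = []
  apart F↦B (F′↦B′ ∷ rest) (B≢B′ ∷ B≢rest) =
    (λ x x∈F x∈F′ → B≢B′ (trans (sym (F↦B x x∈F)) (F′↦B′ x x∈F′))) ∷ apart F↦B rest B≢rest

GoodParts-traces : ∀ {n} (G : Graph n) {q} .{{_ : NonZero q}} {A U : Subset n} {Fs}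
  → All (GoodPart G q A U) Fs
  → Σ (List (Subset n)) λ Bs → Pointwise (CommonTrace G U) Fs Bs × All (Generator G q A U) Bs
GoodParts-traces G []             = [] , [] , []
GoodParts-traces G (good ∷ goods) with GoodPart-trace G good | GoodParts-traces G goods
... | B , F↦B , gen | Bs , Fs↦Bs , gens = B ∷ Bs , F↦B ∷ Fs↦Bs , gen ∷ gens

GoodParts-withTraces : ∀ {n} (G : Graph n) {q} {A U : Subset n} {Bs}
  → All (λ B → q ≤ nB G A U B) Bs
  → Σ (List (Subset n)) λ Fs → Pointwise (CommonTrace G U) Fs Bs × All (GoodPart G q A U) Fs
GoodParts-withTraces G []           = [] , [] , []
GoodParts-withTraces G (gen ∷ gens) with GoodPart-withTrace G gen | GoodParts-withTraces G gens
... | F , F↦B , good | Fs , Fs↦Bs , goods = F ∷ Fs , F↦B ∷ Fs↦Bs , good ∷ goods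

odd-sum-bits : ∀ {n} (Bs : List (Subset n)) u → odd (sum (map (λ B → bit (lookup B u)) Bs)) ≡ sumInd Bs u
odd-sum-bits Bs u =
  trans (odd-sum _ Bs) (ListP.foldr-cong (λ B acc → cong (_xor acc) (odd-bit (lookup B u))) refl Bs)

Balancing : ∀ {n} → Graph n → ℕ → (A U : Subset n) → List (Subset n) → Set
Balancing G q A U Fs = ∀ u v → u ∈ U → v ∈ U → deg G (A ─ unionAll Fs) u ≡ deg G (A ─ unionAll Fs) v [mod 2 * q ]

BalancingFamily : ∀ {n} → Graph n → ℕ → (A U : Subset n) → Set
BalancingFamily {n} G q A U =
  Σ (List (Subset n)) λ Fs → All (GoodPart G q A U) Fs × AllPairs Disjoint Fs × Balancing G q A U Fs

balancingFamily⇔InSpanModConst : ∀ {n} (G : Graph n) {q} .{{_ : NonZero q}} {A U : Subset n} d (b : Fin n → Bool)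
  → U ⊆ A → (∀ v → v ∈ A → deg G A v ≡ d + q * bit (b v) [mod 2 * q ])
  → BalancingFamily G q A U ⇔ InSpanModConst U (Generator G q A U) b
balancingFamily⇔InSpanModConst {n} G {q} {A} {U} d b U⊆A deg≡bit = mk⇔ spanning family
  where
  reduction : ∀ {Fs Bs} → Pointwise (CommonTrace G U) Fs Bs → All (GoodPart G q A U) Fs → AllPairs Disjoint Fs
            → Balancing G q A U Fs ⇔ EqModConst U b (sumInd Bs)
  reduction {Fs} {Bs} Fs↦Bs goods disjoint = ⇔.trans
    (congruentOn⇔EqModConst U d (deg G A) (deg G W) Σbits b (λ u u∈U → deg≡bit u (U⊆A u∈U)) split)
    (EqModConst-cong U b (odd-sum-bits Bs))
    where
    W = A ─ unionAll Fs
    Σbits : Fin n → ℕ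
    Σbits u = sum (map (λ B → bit (lookup B u)) Bs)
    split : ∀ u → u ∈ U → deg G A u ≡ deg G W u + q * Σbits u
    split u u∈U = trans (deg-─ G u (unionAll-⊆ (All.map (λ good {x} → proj₁ ∘ proj₁ good x) goods)))
      (cong (λ m → deg G W u + m) (deg-unionAll G u u∈U Fs↦Bs (All.map (proj₁ ∘ proj₂) goods) disjoint))
  spanning : BalancingFamily G q A U → InSpanModConst U (Generator G q A U) b
  spanning (Fs , goods , disjoint , balanced) with GoodParts-traces G goods
  ... | Bs , Fs↦Bs , gens = Bs , gens , to (reduction Fs↦Bs goods disjoint) balanced
  family : InSpanModConst U (Generator G q A U) b → BalancingFamily G q A U
  family (Bs , gens , b≡Σ) with GoodParts-withTraces G (All.map proj₂ (All-cancelPairs gens))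
  ... | Fs , Fs↦Cs , goods = Fs , goods , disjoint ,
        from (reduction Fs↦Cs goods disjoint) (from (EqModConst-cong U b (sumInd-cancelPairs Bs)) b≡Σ)
    where
    disjoint : AllPairs Disjoint Fs
    disjoint = distinctTraces⇒Disjoint G {U = U} Fs↦Cs (Unique-cancelPairs Bs)

-- Subsets of U with divisible n_B

allSubsets-unique : ∀ n → Unique (allSubsets n)
allSubsets-unique zero    = [] ∷ []
allSubsets-unique (suc n) = Unique.++⁺ (Unique.map⁺ VecP.∷-injectiveʳ (allSubsets-unique n))
                                       (Unique.map⁺ VecP.∷-injectiveʳ (allSubsets-unique n))
                                       heads-differ
  where
  heads-differ : ∀ {v} → ¬ (v ∈ˡ map (outside ∷_) (allSubsets n) × v ∈ˡ map (inside ∷_) (allSubsets n))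
  heads-differ (v∈outside , v∈inside) with ∈-map⁻ (outside ∷_) v∈outside | ∈-map⁻ (inside ∷_) v∈inside
  ... | _ , _ , refl | _ , _ , ()

∈-allSubsets : ∀ {n} (t : Subset n) → t ∈ˡ allSubsets n
∈-allSubsets []            = here refl
∈-allSubsets (outside ∷ t) = ∈-++⁺ˡ (∈-map⁺ (outside ∷_) (∈-allSubsets t))
∈-allSubsets (inside ∷ t)  = ∈-++⁺ʳ _ (∈-map⁺ (inside ∷_) (∈-allSubsets t))

subsetsOf-unique : ∀ {n} (U : Subset n) → Unique (subsetsOf U)
subsetsOf-unique {n} U = Unique.filter⁺ (_⊆? U) (allSubsets-unique n)

∈-subsetsOf : ∀ {n} {U t : Subset n} → t ⊆ U → t ∈ˡ subsetsOf U
∈-subsetsOf {U = U} {t} t⊆U = ∈-filter⁺ (_⊆? U) (∈-allSubsets t) t⊆U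

deg-outside : ∀ {n} (G : Graph n) {A U : Subset n} u → u ∈ U
  → deg G (A ─ U) u ≡ sum (map (λ B → nB G A U B * bit (lookup B u)) (subsetsOf U))
deg-outside {n} G {A} {U} u u∈U = begin
  deg G (A ─ U) u                                    ≡⟨ deg≡∑ G (A ─ U) u ⟩
  ∑[ w < n ] bit (lookup (A ─ U) w ∧ adj G u w)      ≡⟨ sum-cong-≗ pointwise ⟩
  ∑[ w < n ] sum (map (λ B → term B w) L)            ≡⟨ ∑-sum-map-comm L term ⟨
  sum (map (λ B → ∑ (term B)) L)                     ≡⟨ cong sum (ListP.map-cong regroup L) ⟩
  sum (map (λ B → nB G A U B * bit (lookup B u)) L)  ∎
  where
  open ≡-Reasoning
  L = subsetsOf U
  term : Subset n → Fin n → ℕ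
  term B w = bit (tracedOutside G A U B w) * bit (lookup B u)
  regroup : ∀ B → ∑ (term B) ≡ nB G A U B * bit (lookup B u)
  regroup B = trans (sym (*-distribʳ-sum (bit (lookup B u)) (bit ∘ tracedOutside G A U B)))
                    (cong (_* bit (lookup B u)) (sym (nB≡∑ G A U B)))
  classify : ∀ w → bit ((lookup A w ∧ not (lookup U w)) ∧ adj G u w)
           ≡ sum (map (λ B → bit (lookup A w ∧ (not (lookup U w) ∧ ⌊ trace G U w ≟ˢ B ⌋)) * bit (lookup B u)) L)
  classify w with lookup A w | lookup U w
  ... | false | _     = sym (sum-map-zero L)
  ... | true  | true  = sym (sum-map-zero L)
  ... | true  | false = trans (cong bit (adj≡lookup-trace G u w u∈U))
    (sym (sum-map-indicator _≟ˢ_ (λ B → bit (lookup B u)) (subsetsOf-unique U) (∈-subsetsOf (trace⊆ G U w))))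
  pointwise : ∀ w → bit (lookup (A ─ U) w ∧ adj G u w) ≡ sum (map (λ B → term B w) L)
  pointwise w = trans (cong (λ z → bit (z ∧ adj G u w)) (lookup-─ A U w)) (classify w)

modular⇔EqModConst : ∀ {n} (G : Graph n) k {A U : Subset n} d (b : Fin n → Bool)
  → U ⊆ A → (∀ v → v ∈ A → deg G A v ≡ d + 2 ^ k * bit (b v) [mod 2 * 2 ^ k ])
  → (∀ B → B ⊆ U → 2 ^ k ∣ nB G A U B)
  → IsModular G (2 * 2 ^ k) U ⇔ EqModConst U b (weightedSum G k A U)
modular⇔EqModConst {n} G k {A} {U} d b U⊆A deg≡bit q∣nB = ⇔.trans
  (congruentOn⇔EqModConst U d (deg G A) (deg G U) quotients b (λ u u∈U → deg≡bit u (U⊆A u∈U)) split)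
  (EqModConst-cong U b odd-quotients)
  where
  instance
    q≢0 : NonZero (2 ^ k)
    q≢0 = ℕP.m^n≢0 2 k
  L = subsetsOf U
  quotients : Fin n → ℕ
  quotients u = sum (map (λ B → nB G A U B / 2 ^ k * bit (lookup B u)) L)
  split : ∀ u → u ∈ U → deg G A u ≡ deg G U u + 2 ^ k * quotients u
  split u u∈U = begin
    deg G A u                                                 ≡⟨ deg-─ G u U⊆A ⟩
    deg G (A ─ U) u + deg G U u                               ≡⟨ ℕP.+-comm _ (deg G U u) ⟩
    deg G U u + deg G (A ─ U) u                               ≡⟨ cong (λ m → deg G U u + m) (deg-outside G {A} u u∈U) ⟩
    deg G U u + sum (map (λ B → nB G A U B * bit (lookup B u)) L)
      ≡⟨ cong (λ m → deg G U u + m) (sum-map-divisible L (nB G A U) (λ B → bit (lookup B u))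
                                       (All.map (q∣nB _) (all-filter (_⊆? U) (allSubsets n)))) ⟩
    deg G U u + 2 ^ k * quotients u                           ∎
    where open ≡-Reasoning
  odd-quotients : ∀ u → odd (quotients u) ≡ weightedSum G k A U u
  odd-quotients u = trans (odd-sum _ L) (ListP.foldr-cong (λ B acc → cong (_xor acc)
    (trans (odd-*-bit (nB G A U B / 2 ^ k) (lookup B u))
           (cong (_∧ lookup B u) (sym (odd≡%2 (nB G A U B / 2 ^ k)))))) refl L)

-- The hypotheses that A is 2^k-modular and that d lifts its residue follow from the one defining b.
mainTheorem5 : ∀ {n : ℕ} (G : Graph n) (k : ℕ) (A U : Subset n)
    → IsModular G (2 ^ k) A
    → U ⊆ A
    → (d : ℕ) → (∀ v → v ∈ A → deg G A v ≡ d [mod 2 ^ k ])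
    → (b : Fin n → Bool)
    → (∀ v → v ∈ A → deg G A v ≡ d + 2 ^ k * bit (b v) [mod 2 * 2 ^ k ])
    → ((Σ (List (Subset n)) λ Fs →
          All (GoodPart G (2 ^ k) A U) Fs × AllPairs Disjoint Fs
          × (∀ u v → u ∈ U → v ∈ U →
               deg G (A ─ unionAll Fs) u ≡ deg G (A ─ unionAll Fs) v [mod 2 * 2 ^ k ]))
        ⇔ InSpanModConst U (λ B → B ⊆ U × 2 ^ k ≤ nB G A U B) b)
      × ((∀ B → B ⊆ U → 2 ^ k ∣ nB G A U B)
        → (IsModular G (2 * 2 ^ k) U ⇔ EqModConst U b (weightedSum G k A U)))
mainTheorem5 G k A U _ U⊆A d _ b deg≡bit =
  balancingFamily⇔InSpanModConst G {{ℕP.m^n≢0 2 k}} d b U⊆A deg≡bit ,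
  modular⇔EqModConst G k d b U⊆A deg≡bit
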